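{- Let $k\ge1$ be an integer and \[ A_3=\frac{ -q^{6k+1}}{(1+q^{2k+1})^2}+\frac{3q^{4k}}{1+q^{2k+1}}-\frac{5q^{8k+2}}{(1+q^{2k+1})(1+q^{2k+3})}. \] Then the power series $\dfrac{A_3}{(q;q^2)_{\infty}^2(q^2;q^2)_{\infty}(q^4;q^4)_{\infty}^2}$ has non-negative coefficients.
   Context: $(x;q)_\infty=\prod_{j\ge1}(1-xq^{j-1})$. -}

module Defs where

open import Data.Nat using (ℕ; zero; suc; _≡ᵇ_) renaming (_+_ to _+ℕ_; _*_ to _*ℕ_; _∸_ to _∸ℕ_)
open import Data.Integer using (ℤ; +_; -_; _+_; _*_; _-_; 0ℤ; 1ℤ)
open import Data.List using (List; []; _∷_)
open import Data.Bool using (if_then_else_)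

-- Formal power series in q with integer coefficients: n ↦ coefficient of q^n.
PS : Set
PS = ℕ → ℤ

qpow : ℕ → PS
qpow m n = if m ≡ᵇ n then 1ℤ else 0ℤ

one : PS
one = qpow 0

const : ℤ → PS
const c zero    = c
const c (suc n) = 0ℤ

infixl 6 _⊕_ _⊖_
infixl 7 _⊛_

_⊕_ : PS → PS → PS
(f ⊕ g) n = f n + g n

_⊖_ : PS → PS → PS
(f ⊖ g) n = f n - g n

⊝_ : PS → PS
(⊝ f) n = - f n

convAux : PS → PS → ℕ → ℕ → ℤ
convAux f g n zero    = f 0 * g n
convAux f g n (suc i) = f (suc i) * g (n ∸ℕ suc i) + convAux f g n i

_⊛_ : PS → PS → PS
(f ⊛ g) n = convAux f g n n

-- Multiplicative inverse of a power series with constant term 1: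
-- g 0 = 1, g n = - Σ_{i=1}^{n} f i * g (n - i).
-- invRev f n = [g n, g (n-1), ..., g 0].
dotFrom : PS → ℕ → List ℤ → ℤ
dotFrom f i []       = 0ℤ
dotFrom f i (g ∷ gs) = f i * g + dotFrom f (suc i) gs

invRev : PS → ℕ → List ℤ
invRev f zero    = 1ℤ ∷ []
invRev f (suc n) = (- dotFrom f 1 (invRev f n)) ∷ invRev f n

headZ : List ℤ → ℤ
headZ []      = 0ℤ
headZ (x ∷ _) = x

inv : PS → PS
inv f n = headZ (invRev f n)

finPoch : ℕ → ℕ → ℕ → PS
finPoch a s zero    = one
finPoch a s (suc m) = finPoch a s m ⊛ (one ⊖ qpow (a +ℕ s *ℕ m))

-- Infinite q-Pochhammer symbol (q^a; q^s)_∞ = ∏_{j≥1} (1 - q^{a + s(j-1)}),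
-- for a ≥ 1, s ≥ 1.  Its coefficient of q^n equals that of the finite
-- product over j = 1 .. n+1, since all later factors are ≡ 1 mod q^{n+1}.
poch : ℕ → ℕ → PS
poch a s n = finPoch a s (suc n) n

A3 : ℕ → PS
A3 k =
  ⊝ qpow (6 *ℕ k +ℕ 1) ⊛ inv (one ⊕ qpow (2 *ℕ k +ℕ 1)) ⊛ inv (one ⊕ qpow (2 *ℕ k +ℕ 1))
  ⊕ const (+ 3) ⊛ qpow (4 *ℕ k) ⊛ inv (one ⊕ qpow (2 *ℕ k +ℕ 1))
  ⊖ const (+ 5) ⊛ qpow (8 *ℕ k +ℕ 2) ⊛ inv (one ⊕ qpow (2 *ℕ k +ℕ 1)) ⊛ inv (one ⊕ qpow (2 *ℕ k +ℕ 3))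

F3 : ℕ → PS
F3 k = A3 k ⊛ inv (poch 1 2 ⊛ poch 1 2 ⊛ poch 2 2 ⊛ poch 4 4 ⊛ poch 4 4)

module Submission where

-- Put x = q^(2k+1), y = q^(2k+3), w = q^(4k).  For k ≥ 1 the factors of the denominator
-- D = (q;q²)²(q²;q²)(q⁴;q⁴)² include (1−x)²(1−y)(1−q²)(1−x²)(1−w); call the product of
-- the remaining factors E.  Expanding A₃/D by (1+x)²(1+y) gives
--   A₃/D = w (−x(1+y) + 3(1+x)(1+y) − 5x²(1+x)) / ((1−x²)³(1−y²)(1−q²)(1−w) E),
-- and the polynomial in the numerator equals (1+2x)(1−x²) + (3y+2q²)(1−w) + 2(1−q²)(1−x²).
-- In each of the three resulting fractions one factor of the denominator cancels, leaving a
-- polynomial with nonnegative coefficients times the reciprocal of a product of factors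
-- 1 − q^m, which has nonnegative coefficients.

open import Defs
open import Data.Nat using (ℕ; _≤_)
open import Data.Integer using (0ℤ) renaming (_≤_ to _≤ℤ_)

open import Data.Nat as ℕ using (zero; suc; z≤n; s≤s)
import Data.Nat.Properties as ℕₚ
open import Data.Nat.Induction using (<-rec)
open import Data.Nat.Tactic.RingSolver as ℕ-Solver using ()
open import Data.Integer as ℤ using (ℤ; +_; -_; _+_; _-_; _*_; 1ℤ; +≤+)
import Data.Integer.Properties as ℤₚ
open import Data.Integer.Tactic.RingSolver using (solve-∀)
open import Data.Bool using (true; false)
open import Data.List using ([]; _∷_)
open import Data.Maybe using (Maybe; just; nothing)
open import Data.Product using (_,_)
open import Level using (0ℓ)
open import Relation.Nullary using (yes; no)
open import Relation.Binary using (Rel; Setoid)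
open import Relation.Binary.PropositionalEquality
import Relation.Binary.Reasoning.Setoid
open import Algebra.Bundles using (CommutativeRing)
open import Algebra.Structures using (IsCommutativeRing)
import Algebra.Construct.Pointwise as Pointwise
open import Algebra.Properties.CommutativeSemigroup ℤₚ.+-commutativeSemigroup using (x∙yz≈y∙xz)
open import Algebra.Solver.Ring.AlmostCommutativeRing
  using (AlmostCommutativeRing; fromCommutativeRing; _-Raw-AlmostCommutative⟶_)
import Algebra.Solver.Ring as RingSolver

-- The ring of formal power series

infix 4 _≈_
_≈_ : Rel PS 0ℓ
f ≈ g = ∀ n → f n ≡ g n

-- 𝟘 is a constant function so that the additive group is literally the pointwise one, while
-- 𝟙 is const 1ℤ because that is how the ring solver below interprets its constants.
𝟘 𝟙 : PS
𝟘 _ = 0ℤ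
𝟙 = const 1ℤ

tail : PS → PS
tail f n = f (suc n)

⊛-sucˡ : ∀ f g n → (f ⊛ g) (suc n) ≡ f 0 * g (suc n) + (tail f ⊛ g) n
⊛-sucˡ f g n = go n
  where
  go : ∀ i → convAux f g (suc n) (suc i) ≡ f 0 * g (suc n) + convAux (tail f) g n i
  go zero    = ℤₚ.+-comm (f 1 * g n) (f 0 * g (suc n))
  go (suc i) = begin
    f (suc (suc i)) * g (n ℕ.∸ suc i) + convAux f g (suc n) (suc i)
      ≡⟨ cong (_+_ (f (suc (suc i)) * g (n ℕ.∸ suc i))) (go i) ⟩
    f (suc (suc i)) * g (n ℕ.∸ suc i) + (f 0 * g (suc n) + convAux (tail f) g n i)
      ≡⟨ x∙yz≈y∙xz (f (suc (suc i)) * g (n ℕ.∸ suc i)) (f 0 * g (suc n)) (convAux (tail f) g n i) ⟩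
    f 0 * g (suc n) + (f (suc (suc i)) * g (n ℕ.∸ suc i) + convAux (tail f) g n i) ∎
    where open ≡-Reasoning

⊛-sucʳ : ∀ f g n → (f ⊛ g) (suc n) ≡ f (suc n) * g 0 + (f ⊛ tail g) n
⊛-sucʳ f g n rewrite ℕₚ.n∸n≡0 n = cong (_+_ (f (suc n) * g 0)) (go n ℕₚ.≤-refl)
  where
  go : ∀ i → i ℕ.≤ n → convAux f g (suc n) i ≡ convAux f (tail g) n i
  go zero    _   = refl
  go (suc i) i<n = cong₂ (λ m s → f (suc i) * g m + s)
    (ℕₚ.+-∸-assoc 1 i<n) (go i (ℕₚ.<⇒≤ i<n))

⊛-cong : ∀ {f f′ g g′} → f ≈ f′ → g ≈ g′ → f ⊛ g ≈ f′ ⊛ g′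
⊛-cong f≈f′ g≈g′ zero    = cong₂ _*_ (f≈f′ 0) (g≈g′ 0)
⊛-cong {f} {f′} {g} {g′} f≈f′ g≈g′ (suc n) = begin
  (f ⊛ g) (suc n)                      ≡⟨ ⊛-sucˡ f g n ⟩
  f 0 * g (suc n) + (tail f ⊛ g) n     ≡⟨ cong₂ _+_ (cong₂ _*_ (f≈f′ 0) (g≈g′ (suc n)))
                                                    (⊛-cong (λ i → f≈f′ (suc i)) g≈g′ n) ⟩
  f′ 0 * g′ (suc n) + (tail f′ ⊛ g′) n ≡⟨ ⊛-sucˡ f′ g′ n ⟨
  (f′ ⊛ g′) (suc n)                    ∎
  where open ≡-Reasoning

⊛-comm : ∀ f g → f ⊛ g ≈ g ⊛ f
⊛-comm f g zero    = ℤₚ.*-comm (f 0) (g 0)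
⊛-comm f g (suc n) = begin
  (f ⊛ g) (suc n)                  ≡⟨ ⊛-sucˡ f g n ⟩
  f 0 * g (suc n) + (tail f ⊛ g) n ≡⟨ cong₂ _+_ (ℤₚ.*-comm (f 0) _) (⊛-comm (tail f) g n) ⟩
  g (suc n) * f 0 + (g ⊛ tail f) n ≡⟨ ⊛-sucʳ g f n ⟨
  (g ⊛ f) (suc n)                  ∎
  where open ≡-Reasoning

⊛-distribʳ : ∀ h f g → (f ⊕ g) ⊛ h ≈ f ⊛ h ⊕ g ⊛ h
⊛-distribʳ h f g zero    = ℤₚ.*-distribʳ-+ (h 0) (f 0) (g 0)
⊛-distribʳ h f g (suc n) = begin
  ((f ⊕ g) ⊛ h) (suc n)
    ≡⟨ ⊛-sucˡ (f ⊕ g) h n ⟩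
  (f 0 + g 0) * h (suc n) + ((tail f ⊕ tail g) ⊛ h) n
    ≡⟨ cong (_+_ ((f 0 + g 0) * h (suc n))) (⊛-distribʳ h (tail f) (tail g) n) ⟩
  (f 0 + g 0) * h (suc n) + ((tail f ⊛ h) n + (tail g ⊛ h) n)
    ≡⟨ regroup (f 0) (g 0) (h (suc n)) _ _ ⟩
  (f 0 * h (suc n) + (tail f ⊛ h) n) + (g 0 * h (suc n) + (tail g ⊛ h) n)
    ≡⟨ cong₂ _+_ (⊛-sucˡ f h n) (⊛-sucˡ g h n) ⟨
  (f ⊛ h ⊕ g ⊛ h) (suc n) ∎
  where
  open ≡-Reasoning
  regroup : ∀ a b c x y → (a + b) * c + (x + y) ≡ (a * c + x) + (b * c + y)
  regroup = solve-∀

⊛-zeroˡ : ∀ f → 𝟘 ⊛ f ≈ 𝟘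
⊛-zeroˡ f zero    = refl
⊛-zeroˡ f (suc n) = trans (⊛-sucˡ 𝟘 f n) (trans (ℤₚ.+-identityˡ _) (⊛-zeroˡ f n))

⊛-identityˡ : ∀ f → 𝟙 ⊛ f ≈ f
⊛-identityˡ f zero    = ℤₚ.*-identityˡ (f 0)
⊛-identityˡ f (suc n) = begin
  (𝟙 ⊛ f) (suc n)                ≡⟨ ⊛-sucˡ 𝟙 f n ⟩
  1ℤ * f (suc n) + (𝟘 ⊛ f) n     ≡⟨ cong₂ _+_ (ℤₚ.*-identityˡ (f (suc n))) (⊛-zeroˡ f n) ⟩
  f (suc n) + 0ℤ                 ≡⟨ ℤₚ.+-identityʳ (f (suc n)) ⟩
  f (suc n)                      ∎
  where open ≡-Reasoning

scale : ℤ → PS → PS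
scale c f n = c * f n

⊛-scaleˡ : ∀ c f g → scale c f ⊛ g ≈ scale c (f ⊛ g)
⊛-scaleˡ c f g zero    = ℤₚ.*-assoc c (f 0) (g 0)
⊛-scaleˡ c f g (suc n) = begin
  (scale c f ⊛ g) (suc n)                        ≡⟨ ⊛-sucˡ (scale c f) g n ⟩
  c * f 0 * g (suc n) + (scale c (tail f) ⊛ g) n ≡⟨ cong (_+_ (c * f 0 * g (suc n))) (⊛-scaleˡ c (tail f) g n) ⟩
  c * f 0 * g (suc n) + c * (tail f ⊛ g) n       ≡⟨ factor c (f 0) (g (suc n)) _ ⟩
  c * (f 0 * g (suc n) + (tail f ⊛ g) n)         ≡⟨ cong (c *_) (⊛-sucˡ f g n) ⟨
  scale c (f ⊛ g) (suc n)                        ∎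
  where
  open ≡-Reasoning
  factor : ∀ c a b x → c * a * b + c * x ≡ c * (a * b + x)
  factor = solve-∀

⊛-assoc : ∀ f g h → (f ⊛ g) ⊛ h ≈ f ⊛ (g ⊛ h)
⊛-assoc f g h zero    = ℤₚ.*-assoc (f 0) (g 0) (h 0)
⊛-assoc f g h (suc n) = begin
  ((f ⊛ g) ⊛ h) (suc n)
    ≡⟨ ⊛-sucˡ (f ⊛ g) h n ⟩
  f 0 * g 0 * h (suc n) + (tail (f ⊛ g) ⊛ h) n
    ≡⟨ cong (_+_ (f 0 * g 0 * h (suc n))) (⊛-cong (⊛-sucˡ f g) (λ _ → refl) n) ⟩
  f 0 * g 0 * h (suc n) + ((scale (f 0) (tail g) ⊕ tail f ⊛ g) ⊛ h) n
    ≡⟨ cong (_+_ (f 0 * g 0 * h (suc n))) (⊛-distribʳ h _ _ n) ⟩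
  f 0 * g 0 * h (suc n) + ((scale (f 0) (tail g) ⊛ h) n + ((tail f ⊛ g) ⊛ h) n)
    ≡⟨ cong (_+_ (f 0 * g 0 * h (suc n))) (cong₂ _+_ (⊛-scaleˡ (f 0) (tail g) h n) (⊛-assoc (tail f) g h n)) ⟩
  f 0 * g 0 * h (suc n) + (f 0 * (tail g ⊛ h) n + (tail f ⊛ (g ⊛ h)) n)
    ≡⟨ regroup (f 0) (g 0) (h (suc n)) _ _ ⟩
  f 0 * (g 0 * h (suc n) + (tail g ⊛ h) n) + (tail f ⊛ (g ⊛ h)) n
    ≡⟨ cong (λ x → f 0 * x + (tail f ⊛ (g ⊛ h)) n) (⊛-sucˡ g h n) ⟨
  f 0 * (g ⊛ h) (suc n) + (tail f ⊛ (g ⊛ h)) n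
    ≡⟨ ⊛-sucˡ f (g ⊛ h) n ⟨
  (f ⊛ (g ⊛ h)) (suc n) ∎
  where
  open ≡-Reasoning
  regroup : ∀ a b c x y → a * b * c + (a * x + y) ≡ a * (b * c + x) + y
  regroup = solve-∀

⊛-identityʳ : ∀ f → f ⊛ 𝟙 ≈ f
⊛-identityʳ f n = trans (⊛-comm f 𝟙 n) (⊛-identityˡ f n)

⊛-distribˡ : ∀ h f g → h ⊛ (f ⊕ g) ≈ h ⊛ f ⊕ h ⊛ g
⊛-distribˡ h f g n = begin
  (h ⊛ (f ⊕ g)) n           ≡⟨ ⊛-comm h (f ⊕ g) n ⟩
  ((f ⊕ g) ⊛ h) n           ≡⟨ ⊛-distribʳ h f g n ⟩
  (f ⊛ h) n + (g ⊛ h) n     ≡⟨ cong₂ _+_ (⊛-comm f h n) (⊛-comm g h n) ⟩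
  (h ⊛ f ⊕ h ⊛ g) n         ∎
  where open ≡-Reasoning

PS-isCommutativeRing : IsCommutativeRing _≈_ _⊕_ _⊛_ ⊝_ 𝟘 𝟙
PS-isCommutativeRing = record
  { isRing = record
    { +-isAbelianGroup = Pointwise.isAbelianGroup ℕ ℤₚ.+-0-isAbelianGroup
    ; *-cong           = ⊛-cong
    ; *-assoc          = ⊛-assoc
    ; *-identity       = ⊛-identityˡ , ⊛-identityʳ
    ; distrib          = ⊛-distribˡ , ⊛-distribʳ
    }
  ; *-comm = ⊛-comm
  }

PS-commutativeRing : CommutativeRing 0ℓ 0ℓ
PS-commutativeRing = record { isCommutativeRing = PS-isCommutativeRing }

PS-almostCommutativeRing : AlmostCommutativeRing 0ℓ 0ℓ
PS-almostCommutativeRing = fromCommutativeRing PS-commutativeRing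

const-* : ∀ a b → const (a * b) ≈ const a ⊛ const b
const-* a b zero    = refl
const-* a b (suc n) = sym (begin
  (const a ⊛ const b) (suc n)           ≡⟨ ⊛-sucˡ (const a) (const b) n ⟩
  a * 0ℤ + (𝟘 ⊛ const b) n              ≡⟨ cong₂ _+_ (ℤₚ.*-zeroʳ a) (⊛-zeroˡ (const b) n) ⟩
  0ℤ                                    ∎)
  where open ≡-Reasoning

const-morphism : ℤ.+-*-rawRing -Raw-AlmostCommutative⟶ PS-almostCommutativeRing
const-morphism = record
  { ⟦_⟧    = const
  ; +-homo = λ { a b zero → refl ; a b (suc n) → refl }
  ; *-homo = const-*
  ; -‿homo = λ { a zero → refl ; a (suc n) → refl }
  ; 0-homo = λ { zero → refl ; (suc n) → refl }
  ; 1-homo = λ _ → refl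
  }

const-≟ : ∀ a b → Maybe (const a ≈ const b)
const-≟ a b with a ℤ.≟ b
... | yes a≡b = just (λ n → cong (λ c → const c n) a≡b)
... | no  _   = nothing

module PS-Solver = RingSolver ℤ.+-*-rawRing PS-almostCommutativeRing const-morphism const-≟

open PS-Solver using (solve; _:=_; _:+_; _:*_; _:-_; :-_; _:^_; con)

open import Algebra.Properties.Semiring.Exp (CommutativeRing.semiring PS-commutativeRing) using (_^_)

PS-setoid : Setoid 0ℓ 0ℓ
PS-setoid = CommutativeRing.setoid PS-commutativeRing

open Setoid PS-setoid using () renaming (refl to ≈-refl; sym to ≈-sym; trans to ≈-trans)
open CommutativeRing PS-commutativeRing using (+-cong; -‿cong)

⊖-cong : ∀ {f f′ g g′} → f ≈ f′ → g ≈ g′ → f ⊖ g ≈ f′ ⊖ g′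
⊖-cong f≈f′ g≈g′ = +-cong f≈f′ (-‿cong g≈g′)

module ≈-Reasoning = Relation.Binary.Reasoning.Setoid PS-setoid

open import Algebra.Properties.CommutativeSemigroup (CommutativeRing.*-commutativeSemigroup PS-commutativeRing)
  using () renaming (interchange to ⊛-interchange)

⊛-unitʳ : ∀ {x x′ e} → x ≈ x′ → e ≈ 𝟙 → x ⊛ e ≈ x′
⊛-unitʳ {x′ = x′} x≈x′ e≈𝟙 = ≈-trans (⊛-cong x≈x′ e≈𝟙) (⊛-identityʳ x′)

-- Inverses

drop : ℕ → PS → PS
drop i f t = f (i ℕ.+ t)

dotFrom-invRev : ∀ f i m → dotFrom f i (invRev f m) ≡ (drop i f ⊛ inv f) m
dotFrom-invRev f i zero = begin
  f i * 1ℤ + 0ℤ       ≡⟨ ℤₚ.+-identityʳ _ ⟩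
  f i * 1ℤ            ≡⟨ cong (λ j → f j * 1ℤ) (ℕₚ.+-identityʳ i) ⟨
  f (i ℕ.+ 0) * 1ℤ    ∎
  where open ≡-Reasoning
dotFrom-invRev f i (suc m) = begin
  f i * inv f (suc m) + dotFrom f (suc i) (invRev f m)
    ≡⟨ cong₂ _+_ (cong (λ j → f j * inv f (suc m)) (sym (ℕₚ.+-identityʳ i))) (dotFrom-invRev f (suc i) m) ⟩
  f (i ℕ.+ 0) * inv f (suc m) + (drop (suc i) f ⊛ inv f) m
    ≡⟨ cong (_+_ (f (i ℕ.+ 0) * inv f (suc m))) (⊛-cong (λ t → cong f (ℕₚ.+-suc i t)) ≈-refl m) ⟨
  f (i ℕ.+ 0) * inv f (suc m) + (tail (drop i f) ⊛ inv f) m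
    ≡⟨ ⊛-sucˡ (drop i f) (inv f) m ⟨
  (drop i f ⊛ inv f) (suc m) ∎
  where open ≡-Reasoning

⊛-inverseʳ : ∀ f → f 0 ≡ 1ℤ → f ⊛ inv f ≈ 𝟙
⊛-inverseʳ f f₀≡1 zero    = cong (_* 1ℤ) f₀≡1
⊛-inverseʳ f f₀≡1 (suc m) = begin
  (f ⊛ inv f) (suc m)                          ≡⟨ ⊛-sucˡ f (inv f) m ⟩
  f 0 * (- s) + (tail f ⊛ inv f) m             ≡⟨ cong₂ _+_ (cong (_* (- s)) f₀≡1) (sym (dotFrom-invRev f 1 m)) ⟩
  1ℤ * (- s) + s                               ≡⟨ cong (_+ s) (ℤₚ.*-identityˡ (- s)) ⟩
  - s + s                                      ≡⟨ ℤₚ.+-inverseˡ s ⟩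
  0ℤ                                           ∎
  where
  open ≡-Reasoning
  s : ℤ
  s = dotFrom f 1 (invRev f m)

⊛-inverseˡ : ∀ f → f 0 ≡ 1ℤ → inv f ⊛ f ≈ 𝟙
⊛-inverseˡ f f₀≡1 = ≈-trans (⊛-comm (inv f) f) (⊛-inverseʳ f f₀≡1)

inv-unique : ∀ {f g} → f 0 ≡ 1ℤ → g ⊛ f ≈ 𝟙 → g ≈ inv f
inv-unique {f} {g} f₀≡1 g⊛f≈1 = begin
  g                 ≈⟨ ⊛-identityʳ g ⟨
  g ⊛ 𝟙             ≈⟨ ⊛-cong ≈-refl (⊛-inverseʳ f f₀≡1) ⟨
  g ⊛ (f ⊛ inv f)   ≈⟨ ⊛-assoc g f (inv f) ⟨
  (g ⊛ f) ⊛ inv f   ≈⟨ ⊛-cong g⊛f≈1 ≈-refl ⟩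
  𝟙 ⊛ inv f         ≈⟨ ⊛-identityˡ (inv f) ⟩
  inv f             ∎
  where open ≈-Reasoning

dotFrom-cong : ∀ {f g} → f ≈ g → ∀ i xs → dotFrom f i xs ≡ dotFrom g i xs
dotFrom-cong f≈g i []       = refl
dotFrom-cong f≈g i (x ∷ xs) = cong₂ _+_ (cong (_* x) (f≈g i)) (dotFrom-cong f≈g (suc i) xs)

invRev-cong : ∀ {f g} → f ≈ g → ∀ n → invRev f n ≡ invRev g n
invRev-cong f≈g zero    = refl
invRev-cong {f} {g} f≈g (suc n) rewrite invRev-cong f≈g n =
  cong (λ s → - s ∷ invRev g n) (dotFrom-cong f≈g 1 (invRev g n))

inv-cong : ∀ {f g} → f ≈ g → inv f ≈ inv g
inv-cong f≈g n = cong headZ (invRev-cong f≈g n)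

inv-⊛ : ∀ f g → f 0 ≡ 1ℤ → g 0 ≡ 1ℤ → inv (f ⊛ g) ≈ inv f ⊛ inv g
inv-⊛ f g f₀≡1 g₀≡1 = ≈-sym (inv-unique (cong₂ _*_ f₀≡1 g₀≡1) (begin
  (inv f ⊛ inv g) ⊛ (f ⊛ g)  ≈⟨ ⊛-interchange (inv f) (inv g) f g ⟩
  (inv f ⊛ f) ⊛ (inv g ⊛ g)  ≈⟨ ⊛-cong (⊛-inverseˡ f f₀≡1) (⊛-inverseˡ g g₀≡1) ⟩
  𝟙 ⊛ 𝟙                      ≈⟨ ⊛-identityˡ 𝟙 ⟩
  𝟙                          ∎))
  where open ≈-Reasoning

⊛-inv-cancel : ∀ f g h → g 0 ≡ 1ℤ → h 0 ≡ 1ℤ → (f ⊛ h) ⊛ inv (g ⊛ h) ≈ f ⊛ inv g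
⊛-inv-cancel f g h g₀≡1 h₀≡1 = begin
  (f ⊛ h) ⊛ inv (g ⊛ h)      ≈⟨ ⊛-cong ≈-refl (inv-⊛ g h g₀≡1 h₀≡1) ⟩
  (f ⊛ h) ⊛ (inv g ⊛ inv h)  ≈⟨ ⊛-interchange f h (inv g) (inv h) ⟩
  (f ⊛ inv g) ⊛ (h ⊛ inv h)  ≈⟨ ⊛-cong ≈-refl (⊛-inverseʳ h h₀≡1) ⟩
  (f ⊛ inv g) ⊛ 𝟙            ≈⟨ ⊛-identityʳ (f ⊛ inv g) ⟩
  f ⊛ inv g                  ∎
  where open ≈-Reasoning

one≈𝟙 : one ≈ 𝟙
one≈𝟙 zero    = refl
one≈𝟙 (suc n) = refl

qpow-⊛-suc : ∀ e g n → (qpow (suc e) ⊛ g) (suc n) ≡ (qpow e ⊛ g) n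
qpow-⊛-suc e g n = trans (⊛-sucˡ (qpow (suc e)) g n) (ℤₚ.+-identityˡ _)

qpow-⊛-below : ∀ e g {i} → i ℕ.< e → (qpow e ⊛ g) i ≡ 0ℤ
qpow-⊛-below (suc e) g {zero}  _         = refl
qpow-⊛-below (suc e) g {suc i} (s≤s i<e) = trans (qpow-⊛-suc e g i) (qpow-⊛-below e g i<e)

qpow-+ : ∀ m n → qpow (m ℕ.+ n) ≈ qpow m ⊛ qpow n
qpow-+ zero    n i       = sym (trans (⊛-cong one≈𝟙 ≈-refl i) (⊛-identityˡ (qpow n) i))
qpow-+ (suc m) n zero    = refl
qpow-+ (suc m) n (suc i) = trans (qpow-+ m n i) (sym (qpow-⊛-suc m (qpow n) i))

qpow-* : ∀ c m → qpow (c ℕ.* m) ≈ qpow m ^ c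
qpow-* zero    m = one≈𝟙
qpow-* (suc c) m = ≈-trans (qpow-+ m (c ℕ.* m)) (⊛-cong ≈-refl (qpow-* c m))

qpow-monomial : ∀ {e} m c d → e ≡ c ℕ.* m ℕ.+ d → qpow e ≈ qpow m ^ c ⊛ qpow 1 ^ d
qpow-monomial m c d refl = ≈-trans (qpow-+ (c ℕ.* m) d)
  (⊛-cong (qpow-* c m) (≈-trans (λ i → cong (λ e → qpow e i) (sym (ℕₚ.*-identityʳ d))) (qpow-* d 1)))

qpow-0 : ∀ {e} → 0 ℕ.< e → qpow e 0 ≡ 0ℤ
qpow-0 {suc e} _ = refl

-- Nonnegative coefficients

Nonneg : PS → Set
Nonneg f = ∀ n → 0ℤ ℤ.≤ f n

nonneg-resp : ∀ {f g} → f ≈ g → Nonneg f → Nonneg g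
nonneg-resp f≈g f≥0 n = subst (0ℤ ℤ.≤_) (f≈g n) (f≥0 n)

0≤* : ∀ {a b} → 0ℤ ℤ.≤ a → 0ℤ ℤ.≤ b → 0ℤ ℤ.≤ a * b
0≤* {+ m} {+ n} _ _ = subst (0ℤ ℤ.≤_) (ℤₚ.pos-* m n) (+≤+ z≤n)

nonneg-⊕ : ∀ {f g} → Nonneg f → Nonneg g → Nonneg (f ⊕ g)
nonneg-⊕ f≥0 g≥0 n = ℤₚ.+-mono-≤ (f≥0 n) (g≥0 n)

nonneg-⊛ : ∀ {f g} → Nonneg f → Nonneg g → Nonneg (f ⊛ g)
nonneg-⊛ {f} {g} f≥0 g≥0 n = go n
  where
  go : ∀ i → 0ℤ ℤ.≤ convAux f g n i
  go zero    = 0≤* (f≥0 0) (g≥0 n)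
  go (suc i) = ℤₚ.+-mono-≤ (0≤* (f≥0 (suc i)) (g≥0 _)) (go i)

nonneg-const : ∀ c → Nonneg (const (+ c))
nonneg-const c zero    = +≤+ z≤n
nonneg-const c (suc n) = +≤+ z≤n

nonneg-qpow : ∀ e → Nonneg (qpow e)
nonneg-qpow e n with e ℕ.≡ᵇ n
... | true  = +≤+ z≤n
... | false = +≤+ z≤n

nonneg-^ : ∀ {f} → Nonneg f → ∀ c → Nonneg (f ^ c)
nonneg-^ f≥0 zero    = nonneg-const 1
nonneg-^ f≥0 (suc c) = nonneg-⊛ f≥0 (nonneg-^ f≥0 c)

qpow-⊛-nonneg : ∀ e g n → (∀ {m} → m ℕ.< n → 0ℤ ℤ.≤ g m) → 0ℤ ℤ.≤ (qpow (suc e) ⊛ g) n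
qpow-⊛-nonneg e       g zero    _     = +≤+ z≤n
qpow-⊛-nonneg zero    g (suc n) g<n≥0 =
  subst (0ℤ ℤ.≤_) (sym (trans (qpow-⊛-suc 0 g n) (≈-trans (⊛-cong one≈𝟙 ≈-refl) (⊛-identityˡ g) n)))
        (g<n≥0 ℕₚ.≤-refl)
qpow-⊛-nonneg (suc e) g (suc n) g<n≥0 =
  subst (0ℤ ℤ.≤_) (sym (qpow-⊛-suc (suc e) g n)) (qpow-⊛-nonneg e g n (λ m<n → g<n≥0 (ℕₚ.m<n⇒m<1+n m<n)))

nonneg-fixpoint : ∀ {g h} e → Nonneg h → g ≈ h ⊕ qpow (suc e) ⊛ g → Nonneg g
nonneg-fixpoint {g} {h} e h≥0 g≈ = <-rec (λ n → 0ℤ ℤ.≤ g n) step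
  where
  step : ∀ n → (∀ {m} → m ℕ.< n → 0ℤ ℤ.≤ g m) → 0ℤ ℤ.≤ g n
  step n g<n≥0 = subst (0ℤ ℤ.≤_) (sym (g≈ n)) (ℤₚ.+-mono-≤ (h≥0 n) (qpow-⊛-nonneg e g n g<n≥0))

record NonnegReciprocal (f : PS) : Set where
  field
    constant-one : f 0 ≡ 1ℤ
    nonneg-inv   : Nonneg (inv f)

open NonnegReciprocal

nonnegReciprocal-resp : ∀ {f g} → f ≈ g → NonnegReciprocal f → NonnegReciprocal g
nonnegReciprocal-resp f≈g r = record
  { constant-one = trans (sym (f≈g 0)) (constant-one r)
  ; nonneg-inv   = nonneg-resp (inv-cong f≈g) (nonneg-inv r)
  }

nonnegReciprocal-⊛ : ∀ {f g} → NonnegReciprocal f → NonnegReciprocal g → NonnegReciprocal (f ⊛ g)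
nonnegReciprocal-⊛ {f} {g} r s = record
  { constant-one = cong₂ _*_ (constant-one r) (constant-one s)
  ; nonneg-inv   = nonneg-resp (≈-sym (inv-⊛ f g (constant-one r) (constant-one s)))
                               (nonneg-⊛ (nonneg-inv r) (nonneg-inv s))
  }

nonnegReciprocal-𝟙 : NonnegReciprocal 𝟙
nonnegReciprocal-𝟙 = record
  { constant-one = refl
  ; nonneg-inv   = nonneg-resp (inv-unique refl (⊛-identityˡ 𝟙)) (nonneg-const 1)
  }

nonnegReciprocal-𝟙⊖ : ∀ {m} e → m ≈ qpow (suc e) → NonnegReciprocal (𝟙 ⊖ m)
nonnegReciprocal-𝟙⊖ {m} e m≈qᵉ = record
  { constant-one = cong (_-_ 1ℤ) (m≈qᵉ 0)
  ; nonneg-inv   = nonneg-fixpoint e (nonneg-const 1) (begin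
      g                          ≈⟨ split g m ⟩
      g ⊛ (𝟙 ⊖ m) ⊕ m ⊛ g        ≈⟨ +-cong (⊛-inverseˡ (𝟙 ⊖ m) (cong (_-_ 1ℤ) (m≈qᵉ 0))) (⊛-cong m≈qᵉ ≈-refl) ⟩
      𝟙 ⊕ qpow (suc e) ⊛ g       ∎)
  }
  where
  open ≈-Reasoning
  g : PS
  g = inv (𝟙 ⊖ m)
  split : ∀ g m → g ≈ g ⊛ (𝟙 ⊖ m) ⊕ m ⊛ g
  split = solve 2 (λ g m → g := g :* (con 1ℤ :- m) :+ m :* g) ≈-refl

nonneg-cancel : ∀ {t c r g} → Nonneg t → NonnegReciprocal r → c 0 ≡ 1ℤ → g ≈ r ⊛ c →
                Nonneg ((t ⊛ c) ⊛ inv g)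
nonneg-cancel {t} {c} {r} t≥0 r≥0 c₀≡1 g≈r⊛c = nonneg-resp
  (≈-sym (≈-trans (⊛-cong ≈-refl (inv-cong g≈r⊛c)) (⊛-inv-cancel t r c (constant-one r≥0) c₀≡1)))
  (nonneg-⊛ t≥0 (nonneg-inv r≥0))

-- Agreement modulo q^n

infix 4 _≈_mod_
_≈_mod_ : PS → PS → ℕ → Set
f ≈ g mod n = ∀ {i} → i ℕ.< n → f i ≡ g i

≈⇒≈mod : ∀ {f g} n → f ≈ g → f ≈ g mod n
≈⇒≈mod n f≈g {i} _ = f≈g i

mod-weaken : ∀ {f g m n} → m ℕ.≤ n → f ≈ g mod n → f ≈ g mod m
mod-weaken m≤n f≈g i<m = f≈g (ℕₚ.<-≤-trans i<m m≤n)

⊛-cong-mod : ∀ {f f′ g g′ n} → f ≈ f′ mod n → g ≈ g′ mod n → f ⊛ g ≈ f′ ⊛ g′ mod n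
⊛-cong-mod f≈f′ g≈g′ {i} i<n = go i (mod-weaken i<n f≈f′) (mod-weaken i<n g≈g′)
  where
  go : ∀ i {f f′ g g′} → f ≈ f′ mod suc i → g ≈ g′ mod suc i → (f ⊛ g) i ≡ (f′ ⊛ g′) i
  go zero    f≈f′ g≈g′ = cong₂ _*_ (f≈f′ (s≤s z≤n)) (g≈g′ (s≤s z≤n))
  go (suc i) {f} {f′} {g} {g′} f≈f′ g≈g′ = begin
    (f ⊛ g) (suc i)                      ≡⟨ ⊛-sucˡ f g i ⟩
    f 0 * g (suc i) + (tail f ⊛ g) i     ≡⟨ cong₂ _+_ (cong₂ _*_ (f≈f′ (s≤s z≤n)) (g≈g′ ℕₚ.≤-refl))
                                                      (go i (λ j<i → f≈f′ (s≤s j<i)) (mod-weaken (ℕₚ.n≤1+n _) g≈g′)) ⟩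
    f′ 0 * g′ (suc i) + (tail f′ ⊛ g′) i ≡⟨ ⊛-sucˡ f′ g′ i ⟨
    (f′ ⊛ g′) (suc i)                    ∎
    where open ≡-Reasoning

inv-cong-mod : ∀ {f g n} → f 0 ≡ 1ℤ → g 0 ≡ 1ℤ → f ≈ g mod n → inv f ≈ inv g mod n
inv-cong-mod {f} {g} f₀≡1 g₀≡1 f≈g {i} i<n = begin
  inv f i                      ≡⟨ ⊛-identityʳ (inv f) i ⟨
  (inv f ⊛ 𝟙) i                ≡⟨ ⊛-cong ≈-refl (⊛-inverseʳ g g₀≡1) i ⟨
  (inv f ⊛ (g ⊛ inv g)) i      ≡⟨ ⊛-assoc (inv f) g (inv g) i ⟨
  ((inv f ⊛ g) ⊛ inv g) i      ≡⟨ ⊛-cong-mod (⊛-cong-mod (≈⇒≈mod _ (≈-refl {x = inv f})) (λ j<n → sym (f≈g j<n)))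
                                             (≈⇒≈mod _ (≈-refl {x = inv g})) i<n ⟩
  ((inv f ⊛ f) ⊛ inv g) i      ≡⟨ ⊛-cong (⊛-inverseˡ f f₀≡1) ≈-refl i ⟩
  (𝟙 ⊛ inv g) i                ≡⟨ ⊛-identityˡ (inv g) i ⟩
  inv g i                      ∎
  where open ≡-Reasoning

⊛-one⊖qpow-mod : ∀ f e → f ⊛ (one ⊖ qpow e) ≈ f mod e
⊛-one⊖qpow-mod f e {i} i<e = begin
  (f ⊛ (one ⊖ qpow e)) i          ≡⟨ ⊛-cong ≈-refl (λ j → cong (_- qpow e j) (one≈𝟙 j)) i ⟩
  (f ⊛ (𝟙 ⊖ qpow e)) i            ≡⟨ expand f (qpow e) i ⟩
  f i - (qpow e ⊛ f) i            ≡⟨ cong (_-_ (f i)) (qpow-⊛-below e f i<e) ⟩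
  f i - 0ℤ                        ≡⟨ ℤₚ.+-identityʳ (f i) ⟩
  f i                             ∎
  where
  open ≡-Reasoning
  expand : ∀ f m → f ⊛ (𝟙 ⊖ m) ≈ f ⊖ m ⊛ f
  expand = solve 2 (λ f m → f :* (con 1ℤ :- m) := f :- m :* f) ≈-refl

-- q-Pochhammer symbols

finPoch-+ : ∀ a s j m → finPoch a s (m ℕ.+ j) ≈ finPoch a s j ⊛ finPoch (a ℕ.+ s ℕ.* j) s m
finPoch-+ a s j zero    = ≈-sym (≈-trans (⊛-cong ≈-refl one≈𝟙) (⊛-identityʳ (finPoch a s j)))
finPoch-+ a s j (suc m) = begin
  finPoch a s (m ℕ.+ j) ⊛ (one ⊖ qpow (a ℕ.+ s ℕ.* (m ℕ.+ j)))
    ≈⟨ ⊛-cong (finPoch-+ a s j m) (λ i → cong (λ e → (one ⊖ qpow e) i) (exponent a s j m)) ⟩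
  (finPoch a s j ⊛ finPoch (a ℕ.+ s ℕ.* j) s m) ⊛ (one ⊖ qpow (a ℕ.+ s ℕ.* j ℕ.+ s ℕ.* m))
    ≈⟨ ⊛-assoc _ _ _ ⟩
  finPoch a s j ⊛ finPoch (a ℕ.+ s ℕ.* j) s (suc m) ∎
  where
  open ≈-Reasoning
  exponent : ∀ a s j m → a ℕ.+ s ℕ.* (m ℕ.+ j) ≡ a ℕ.+ s ℕ.* j ℕ.+ s ℕ.* m
  exponent = ℕ-Solver.solve-∀

finPoch-stable : ∀ a s m d → finPoch a s m ≈ finPoch a s (d ℕ.+ m) mod a ℕ.+ s ℕ.* m
finPoch-stable a s m zero    = ≈⇒≈mod _ (≈-refl {x = finPoch a s m})
finPoch-stable a s m (suc d) i<e = trans (finPoch-stable a s m d i<e)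
  (sym (⊛-one⊖qpow-mod (finPoch a s (d ℕ.+ m)) _ (ℕₚ.<-≤-trans i<e e≤e′)))
  where
  e≤e′ : a ℕ.+ s ℕ.* m ℕ.≤ a ℕ.+ s ℕ.* (d ℕ.+ m)
  e≤e′ = ℕₚ.+-monoʳ-≤ a (ℕₚ.*-monoʳ-≤ s (ℕₚ.m≤n+m m d))

poch-≈-finPoch : ∀ a s n → poch a (suc s) ≈ finPoch a (suc s) n mod n
poch-≈-finPoch a s n {i} i<n = begin
  finPoch a (suc s) (suc i) i                     ≡⟨ finPoch-stable a (suc s) (suc i) (n ℕ.∸ suc i) i<e ⟩
  finPoch a (suc s) (n ℕ.∸ suc i ℕ.+ suc i) i     ≡⟨ cong (λ m → finPoch a (suc s) m i) (ℕₚ.m∸n+n≡m i<n) ⟩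
  finPoch a (suc s) n i                           ∎
  where
  open ≡-Reasoning
  i<e : i ℕ.< a ℕ.+ suc s ℕ.* suc i
  i<e = ℕₚ.≤-trans (ℕₚ.m≤m+n (suc i) (s ℕ.* suc i)) (ℕₚ.m≤n+m _ a)

poch-split : ∀ a s j → poch a (suc s) ≈ finPoch a (suc s) j ⊛ poch (a ℕ.+ suc s ℕ.* j) (suc s)
poch-split a s j n = begin
  poch a (suc s) n
    ≡⟨ poch-≈-finPoch a s (suc n ℕ.+ j) (s≤s (ℕₚ.m≤m+n n j)) ⟩
  finPoch a (suc s) (suc n ℕ.+ j) n
    ≡⟨ finPoch-+ a (suc s) j (suc n) n ⟩
  (finPoch a (suc s) j ⊛ finPoch b (suc s) (suc n)) n
    ≡⟨ ⊛-cong-mod (≈⇒≈mod _ (≈-refl {x = finPoch a (suc s) j})) (λ i<n → sym (poch-≈-finPoch b s (suc n) i<n))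
                  (ℕₚ.n<1+n n) ⟩
  (finPoch a (suc s) j ⊛ poch b (suc s)) n ∎
  where
  open ≡-Reasoning
  b : ℕ
  b = a ℕ.+ suc s ℕ.* j

nonnegReciprocal-one⊖ : ∀ e → NonnegReciprocal (one ⊖ qpow (suc e))
nonnegReciprocal-one⊖ e =
  nonnegReciprocal-resp (λ i → cong (_- qpow (suc e) i) (sym (one≈𝟙 i))) (nonnegReciprocal-𝟙⊖ e ≈-refl)

nonnegReciprocal-finPoch : ∀ a s m → NonnegReciprocal (finPoch (suc a) s m)
nonnegReciprocal-finPoch a s zero    = nonnegReciprocal-resp (≈-sym one≈𝟙) nonnegReciprocal-𝟙
nonnegReciprocal-finPoch a s (suc m) =
  nonnegReciprocal-⊛ (nonnegReciprocal-finPoch a s m) (nonnegReciprocal-one⊖ (a ℕ.+ s ℕ.* m))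

nonnegReciprocal-poch : ∀ a s → NonnegReciprocal (poch (suc a) (suc s))
nonnegReciprocal-poch a s = record
  { constant-one = refl
  ; nonneg-inv   = λ n → subst (0ℤ ℤ.≤_)
      (sym (inv-cong-mod refl (constant-one (finPoch′ n)) (poch-≈-finPoch (suc a) s (suc n)) (ℕₚ.n<1+n n)))
      (nonneg-inv (finPoch′ n) n)
  }
  where
  finPoch′ : ∀ n → NonnegReciprocal (finPoch (suc a) (suc s) (suc n))
  finPoch′ n = nonnegReciprocal-finPoch a (suc s) (suc n)

-- Every exponent below has the form 2kc + d; writing q^(2kc+d) as K^c Q^d exposes the
-- relations between these monomials to the ring solver.
module Monomials (k : ℕ) where

  K Q : PS
  K = qpow (2 ℕ.* k)
  Q = qpow 1

  mono : ℕ → ℕ → PS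
  mono c d = K ^ c ⊛ Q ^ d

  qpow≈mono : ∀ e c d → e ≡ c ℕ.* (2 ℕ.* k) ℕ.+ d → qpow e ≈ mono c d
  qpow≈mono _ = qpow-monomial (2 ℕ.* k)

  nonneg-mono : ∀ c d → Nonneg (mono c d)
  nonneg-mono c d = nonneg-⊛ (nonneg-^ (nonneg-qpow (2 ℕ.* k)) c) (nonneg-^ (nonneg-qpow 1) d)

  1+x 1+y 1−x 1−y 1−q² 1−x² 1−y² 1−w : PS
  1+x  = 𝟙 ⊕ mono 1 1
  1+y  = 𝟙 ⊕ mono 1 3
  1−x  = 𝟙 ⊖ mono 1 1
  1−y  = 𝟙 ⊖ mono 1 3
  1−q² = 𝟙 ⊖ mono 0 2
  1−x² = 𝟙 ⊖ mono 2 2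
  1−y² = 𝟙 ⊖ mono 2 6
  1−w  = 𝟙 ⊖ mono 2 0

  n₁ n₂ n₃ : PS
  n₁ = mono 2 0 ⊛ (𝟙 ⊕ const (+ 2) ⊛ mono 1 1)
  n₂ = mono 2 0 ⊛ (const (+ 3) ⊛ mono 1 3 ⊕ const (+ 2) ⊛ mono 0 2)
  n₃ = const (+ 2) ⊛ mono 2 0

  nonneg-n₁ : Nonneg n₁
  nonneg-n₁ = nonneg-⊛ (nonneg-mono 2 0)
    (nonneg-⊕ (nonneg-const 1) (nonneg-⊛ (nonneg-const 2) (nonneg-mono 1 1)))

  nonneg-n₂ : Nonneg n₂
  nonneg-n₂ = nonneg-⊛ (nonneg-mono 2 0)
    (nonneg-⊕ (nonneg-⊛ (nonneg-const 3) (nonneg-mono 1 3)) (nonneg-⊛ (nonneg-const 2) (nonneg-mono 0 2)))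

  nonneg-n₃ : Nonneg n₃
  nonneg-n₃ = nonneg-⊛ (nonneg-const 2) (nonneg-mono 2 0)

  numerator-identity :
    ⊝ mono 3 1 ⊛ 1+y ⊕ const (+ 3) ⊛ mono 2 0 ⊛ (1+x ⊛ 1+y) ⊖ const (+ 5) ⊛ mono 4 2 ⊛ 1+x
      ≈ n₁ ⊛ 1−x² ⊕ n₂ ⊛ 1−w ⊕ n₃ ⊛ (1−q² ⊛ 1−x²)
  numerator-identity = solve 2 (λ K Q → let m = λ c d → K :^ c :* Q :^ d ; 𝟙′ = con 1ℤ in
      :- m 3 1 :* (𝟙′ :+ m 1 3) :+ con (+ 3) :* m 2 0 :* ((𝟙′ :+ m 1 1) :* (𝟙′ :+ m 1 3))
        :- con (+ 5) :* m 4 2 :* (𝟙′ :+ m 1 1)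
    := m 2 0 :* (𝟙′ :+ con (+ 2) :* m 1 1) :* (𝟙′ :- m 2 2)
      :+ m 2 0 :* (con (+ 3) :* m 1 3 :+ con (+ 2) :* m 0 2) :* (𝟙′ :- m 2 0)
      :+ con (+ 2) :* m 2 0 :* ((𝟙′ :- m 0 2) :* (𝟙′ :- m 2 2))) ≈-refl K Q

  difference-of-squares : ∀ E →
    (1−x ⊛ 1−x ⊛ 1−y ⊛ 1−q² ⊛ 1−x² ⊛ 1−w ⊛ E) ⊛ (1+x ⊛ 1+x ⊛ 1+y) ≈
    1−x² ⊛ 1−x² ⊛ 1−x² ⊛ 1−y² ⊛ 1−q² ⊛ 1−w ⊛ E
  difference-of-squares = solve 3 (λ K Q E → let m = λ c d → K :^ c :* Q :^ d ; 𝟙′ = con 1ℤ in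
      ((𝟙′ :- m 1 1) :* (𝟙′ :- m 1 1) :* (𝟙′ :- m 1 3) :* (𝟙′ :- m 0 2) :* (𝟙′ :- m 2 2) :* (𝟙′ :- m 2 0) :* E)
        :* ((𝟙′ :+ m 1 1) :* (𝟙′ :+ m 1 1) :* (𝟙′ :+ m 1 3))
    := (𝟙′ :- m 2 2) :* (𝟙′ :- m 2 2) :* (𝟙′ :- m 2 2) :* (𝟙′ :- m 2 6) :* (𝟙′ :- m 0 2) :* (𝟙′ :- m 2 0) :* E)
    ≈-refl K Q

module _ (k : ℕ) where
  open Monomials k

  one⊕x one⊕y : PS
  one⊕x = one ⊕ qpow (2 ℕ.* k ℕ.+ 1)
  one⊕y = one ⊕ qpow (2 ℕ.* k ℕ.+ 3)

  1+x≈ : one⊕x ≈ 1+x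
  1+x≈ = +-cong one≈𝟙 (qpow≈mono (2 ℕ.* k ℕ.+ 1) 1 1 (ℕ-Solver.solve (k ∷ [])))

  1+y≈ : one⊕y ≈ 1+y
  1+y≈ = +-cong one≈𝟙 (qpow≈mono (2 ℕ.* k ℕ.+ 3) 1 3 (ℕ-Solver.solve (k ∷ [])))

  one⊕x-constant : one⊕x 0 ≡ 1ℤ
  one⊕x-constant = cong (_+_ 1ℤ) (qpow-0 (ℕₚ.m≤n+m 1 (2 ℕ.* k)))

  one⊕y-constant : one⊕y 0 ≡ 1ℤ
  one⊕y-constant = cong (_+_ 1ℤ) (qpow-0 (ℕₚ.≤-trans (s≤s z≤n) (ℕₚ.m≤n+m 3 (2 ℕ.* k))))

  A3-cleared : A3 k ⊛ (one⊕x ⊛ one⊕x ⊛ one⊕y) ≈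
    ⊝ mono 3 1 ⊛ 1+y ⊕ const (+ 3) ⊛ mono 2 0 ⊛ (1+x ⊛ 1+y) ⊖ const (+ 5) ⊛ mono 4 2 ⊛ 1+x
  A3-cleared = begin
    A3 k ⊛ (one⊕x ⊛ one⊕x ⊛ one⊕y)
      ≈⟨ regroup t₁ t₂ t₃ one⊕x one⊕y (inv one⊕x) (inv one⊕y) ⟩
    (⊝ t₁ ⊛ one⊕y ⊛ (inv one⊕x ⊛ one⊕x) ⊕ const (+ 3) ⊛ t₂ ⊛ (one⊕x ⊛ one⊕y)
      ⊖ const (+ 5) ⊛ t₃ ⊛ one⊕x ⊛ (inv one⊕y ⊛ one⊕y)) ⊛ (inv one⊕x ⊛ one⊕x)
      ≈⟨ ⊛-unitʳ (⊖-cong (+-cong (⊛-unitʳ (⊛-cong (-‿cong t₁≈) 1+y≈) x-cancels)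
                                 (⊛-cong (⊛-cong ≈-refl t₂≈) (⊛-cong 1+x≈ 1+y≈)))
                         (⊛-unitʳ (⊛-cong (⊛-cong ≈-refl t₃≈) 1+x≈) y-cancels))
                 x-cancels ⟩
    ⊝ mono 3 1 ⊛ 1+y ⊕ const (+ 3) ⊛ mono 2 0 ⊛ (1+x ⊛ 1+y) ⊖ const (+ 5) ⊛ mono 4 2 ⊛ 1+x ∎
    where
    open ≈-Reasoning
    t₁ t₂ t₃ : PS
    t₁ = qpow (6 ℕ.* k ℕ.+ 1)
    t₂ = qpow (4 ℕ.* k)
    t₃ = qpow (8 ℕ.* k ℕ.+ 2)
    t₁≈ : t₁ ≈ mono 3 1
    t₁≈ = qpow≈mono (6 ℕ.* k ℕ.+ 1) 3 1 (ℕ-Solver.solve (k ∷ []))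
    t₂≈ : t₂ ≈ mono 2 0
    t₂≈ = qpow≈mono (4 ℕ.* k) 2 0 (ℕ-Solver.solve (k ∷ []))
    t₃≈ : t₃ ≈ mono 4 2
    t₃≈ = qpow≈mono (8 ℕ.* k ℕ.+ 2) 4 2 (ℕ-Solver.solve (k ∷ []))
    x-cancels : inv one⊕x ⊛ one⊕x ≈ 𝟙
    x-cancels = ⊛-inverseˡ one⊕x one⊕x-constant
    y-cancels : inv one⊕y ⊛ one⊕y ≈ 𝟙
    y-cancels = ⊛-inverseˡ one⊕y one⊕y-constant
    regroup : ∀ a b c p p′ u u′ →
      (⊝ a ⊛ u ⊛ u ⊕ const (+ 3) ⊛ b ⊛ u ⊖ const (+ 5) ⊛ c ⊛ u ⊛ u′) ⊛ (p ⊛ p ⊛ p′) ≈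
      (⊝ a ⊛ p′ ⊛ (u ⊛ p) ⊕ const (+ 3) ⊛ b ⊛ (p ⊛ p′) ⊖ const (+ 5) ⊛ c ⊛ p ⊛ (u′ ⊛ p′)) ⊛ (u ⊛ p)
    regroup = solve 7 (λ a b c p p′ u u′ →
      (:- a :* u :* u :+ con (+ 3) :* b :* u :- con (+ 5) :* c :* u :* u′) :* (p :* p :* p′) :=
      (:- a :* p′ :* (u :* p) :+ con (+ 3) :* b :* (p :* p′) :- con (+ 5) :* c :* p :* (u′ :* p′)) :* (u :* p)) ≈-refl

-- Only for k = suc k′ are 1−q² and 1−x² distinct factors of (q²;q²)∞ and is 1−w a factor
-- of (q⁴;q⁴)∞.
module _ (k′ : ℕ) where
  open Monomials (suc k′)

  private
    infixl 7 _·_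
    _·_ : ∀ {f g} → NonnegReciprocal f → NonnegReciprocal g → NonnegReciprocal (f ⊛ g)
    _·_ = nonnegReciprocal-⊛

  D E : PS
  D = poch 1 2 ⊛ poch 1 2 ⊛ poch 2 2 ⊛ poch 4 4 ⊛ poch 4 4
  E = finPoch 1 2 (suc k′) ⊛ poch (1 ℕ.+ 2 ℕ.* suc (suc (suc k′))) 2
    ⊛ finPoch 1 2 (suc k′) ⊛ poch (1 ℕ.+ 2 ℕ.* suc (suc k′)) 2
    ⊛ finPoch 4 2 (suc (2 ℕ.* k′)) ⊛ poch (4 ℕ.+ 2 ℕ.* suc (suc (2 ℕ.* k′))) 2
    ⊛ finPoch 4 4 k′ ⊛ poch (4 ℕ.+ 4 ℕ.* suc k′) 4 ⊛ poch 4 4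

  1−x≈ : one ⊖ qpow (1 ℕ.+ 2 ℕ.* suc k′) ≈ 1−x
  1−x≈ = ⊖-cong one≈𝟙 (qpow≈mono (1 ℕ.+ 2 ℕ.* suc k′) 1 1 (ℕ-Solver.solve (k′ ∷ [])))

  1−y≈ : one ⊖ qpow (1 ℕ.+ 2 ℕ.* suc (suc k′)) ≈ 1−y
  1−y≈ = ⊖-cong one≈𝟙 (qpow≈mono (1 ℕ.+ 2 ℕ.* suc (suc k′)) 1 3 (ℕ-Solver.solve (k′ ∷ [])))

  1−q²≈ : finPoch 2 2 1 ≈ 1−q²
  1−q²≈ = ≈-trans (⊛-cong one≈𝟙 ≈-refl) (≈-trans (⊛-identityˡ _) (⊖-cong one≈𝟙 (qpow≈mono 2 0 2 refl)))

  1−x²≈ : one ⊖ qpow (4 ℕ.+ 2 ℕ.* suc (2 ℕ.* k′)) ≈ 1−x²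
  1−x²≈ = ⊖-cong one≈𝟙 (qpow≈mono (4 ℕ.+ 2 ℕ.* suc (2 ℕ.* k′)) 2 2 (ℕ-Solver.solve (k′ ∷ [])))

  1−w≈ : one ⊖ qpow (4 ℕ.+ 4 ℕ.* k′) ≈ 1−w
  1−w≈ = ⊖-cong one≈𝟙 (qpow≈mono (4 ℕ.+ 4 ℕ.* k′) 2 0 (ℕ-Solver.solve (k′ ∷ [])))

  D-factor : D ≈ 1−x ⊛ 1−x ⊛ 1−y ⊛ 1−q² ⊛ 1−x² ⊛ 1−w ⊛ E
  D-factor = ≈-trans
    (⊛-cong (⊛-cong (⊛-cong (⊛-cong (poch-split 1 1 (suc (suc (suc k′)))) (poch-split 1 1 (suc (suc k′))))
                            (≈-trans (poch-split 2 1 1) (⊛-cong ≈-refl (poch-split 4 1 (suc (suc (2 ℕ.* k′)))))))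
                    (poch-split 4 3 (suc k′)))
            ≈-refl)
    (≈-trans (regroup _ _ _ _ _ _ _ _ _ _ _ _ _)
             (⊛-cong (⊛-cong (⊛-cong (⊛-cong (⊛-cong (⊛-cong 1−x≈ 1−x≈) 1−y≈) 1−q²≈) 1−x²≈) 1−w≈) ≈-refl))
    where
    regroup : ∀ r₁ x y s₁ s₁′ q r₂ x² s₂ r₄ w s₄ p₄ →
      ((r₁ ⊛ x ⊛ y) ⊛ s₁) ⊛ ((r₁ ⊛ x) ⊛ s₁′) ⊛ (q ⊛ ((r₂ ⊛ x²) ⊛ s₂)) ⊛ ((r₄ ⊛ w) ⊛ s₄) ⊛ p₄ ≈
      x ⊛ x ⊛ y ⊛ q ⊛ x² ⊛ w ⊛ (r₁ ⊛ s₁ ⊛ r₁ ⊛ s₁′ ⊛ r₂ ⊛ s₂ ⊛ r₄ ⊛ s₄ ⊛ p₄)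
    regroup = solve 13 (λ r₁ x y s₁ s₁′ q r₂ x² s₂ r₄ w s₄ p₄ →
      ((r₁ :* x :* y) :* s₁) :* ((r₁ :* x) :* s₁′) :* (q :* ((r₂ :* x²) :* s₂)) :* ((r₄ :* w) :* s₄) :* p₄ :=
      x :* x :* y :* q :* x² :* w :* (r₁ :* s₁ :* r₁ :* s₁′ :* r₂ :* s₂ :* r₄ :* s₄ :* p₄)) ≈-refl

  V : PS
  V = 1−x² ⊛ 1−x² ⊛ 1−x² ⊛ 1−y² ⊛ 1−q² ⊛ 1−w

  D-cleared : D ⊛ (one⊕x (suc k′) ⊛ one⊕x (suc k′) ⊛ one⊕y (suc k′)) ≈ V ⊛ E
  D-cleared = ≈-trans (⊛-cong D-factor (⊛-cong (⊛-cong (1+x≈ (suc k′)) (1+x≈ (suc k′))) (1+y≈ (suc k′))))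
                      (difference-of-squares E)

  F3≈ : F3 (suc k′) ≈ (n₁ ⊛ 1−x² ⊕ n₂ ⊛ 1−w ⊕ n₃ ⊛ (1−q² ⊛ 1−x²)) ⊛ inv (V ⊛ E)
  F3≈ = begin
    A3 (suc k′) ⊛ inv D               ≈⟨ ⊛-inv-cancel (A3 (suc k′)) D B refl B-constant ⟨
    (A3 (suc k′) ⊛ B) ⊛ inv (D ⊛ B)   ≈⟨ ⊛-cong (≈-trans (A3-cleared (suc k′)) numerator-identity)
                                                (inv-cong D-cleared) ⟩
    (n₁ ⊛ 1−x² ⊕ n₂ ⊛ 1−w ⊕ n₃ ⊛ (1−q² ⊛ 1−x²)) ⊛ inv (V ⊛ E) ∎
    where
    open ≈-Reasoning
    B : PS
    B = one⊕x (suc k′) ⊛ one⊕x (suc k′) ⊛ one⊕y (suc k′)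
    B-constant : B 0 ≡ 1ℤ
    B-constant = cong₂ _*_ (cong₂ _*_ (one⊕x-constant (suc k′)) (one⊕x-constant (suc k′))) (one⊕y-constant (suc k′))

  E⁻¹≥0 : NonnegReciprocal E
  E⁻¹≥0 = nonnegReciprocal-finPoch 0 2 (suc k′) · nonnegReciprocal-poch (2 ℕ.* suc (suc (suc k′))) 1
        · nonnegReciprocal-finPoch 0 2 (suc k′) · nonnegReciprocal-poch (2 ℕ.* suc (suc k′)) 1
        · nonnegReciprocal-finPoch 3 2 (suc (2 ℕ.* k′)) · nonnegReciprocal-poch (3 ℕ.+ 2 ℕ.* suc (suc (2 ℕ.* k′))) 1
        · nonnegReciprocal-finPoch 3 4 k′ · nonnegReciprocal-poch (3 ℕ.+ 4 ℕ.* suc k′) 3 · nonnegReciprocal-poch 3 3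

  1−q²⁻¹≥0 : NonnegReciprocal 1−q²
  1−q²⁻¹≥0 = nonnegReciprocal-resp 1−q²≈ (nonnegReciprocal-finPoch 1 2 1)

  1−x²⁻¹≥0 : NonnegReciprocal 1−x²
  1−x²⁻¹≥0 = nonnegReciprocal-resp 1−x²≈ (nonnegReciprocal-one⊖ (3 ℕ.+ 2 ℕ.* suc (2 ℕ.* k′)))

  1−w⁻¹≥0 : NonnegReciprocal 1−w
  1−w⁻¹≥0 = nonnegReciprocal-resp 1−w≈ (nonnegReciprocal-one⊖ (3 ℕ.+ 4 ℕ.* k′))

  1−y²⁻¹≥0 : NonnegReciprocal 1−y²
  1−y²⁻¹≥0 = nonnegReciprocal-𝟙⊖ _ (≈-sym (qpow≈mono (10 ℕ.+ 4 ℕ.* k′) 2 6 (ℕ-Solver.solve (k′ ∷ []))))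

  F3-nonneg : Nonneg (F3 (suc k′))
  F3-nonneg = nonneg-resp (≈-sym F3≈)
    (nonneg-resp (≈-sym (distribute _ _ _ _)) (nonneg-⊕ (nonneg-⊕ term₁ term₂) term₃))
    where
    distribute : ∀ a b c h → (a ⊕ b ⊕ c) ⊛ h ≈ a ⊛ h ⊕ b ⊛ h ⊕ c ⊛ h
    distribute = solve 4 (λ a b c h → (a :+ b :+ c) :* h := a :* h :+ b :* h :+ c :* h) ≈-refl
    regroup₁ : ∀ a b c d e → a ⊛ a ⊛ a ⊛ b ⊛ c ⊛ d ⊛ e ≈ (a ⊛ a ⊛ b ⊛ c ⊛ d ⊛ e) ⊛ a
    regroup₁ = solve 5 (λ a b c d e → a :* a :* a :* b :* c :* d :* e := (a :* a :* b :* c :* d :* e) :* a) ≈-refl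
    regroup₂ : ∀ a b c d e → a ⊛ a ⊛ a ⊛ b ⊛ c ⊛ d ⊛ e ≈ (a ⊛ a ⊛ a ⊛ b ⊛ c ⊛ e) ⊛ d
    regroup₂ = solve 5 (λ a b c d e → a :* a :* a :* b :* c :* d :* e := (a :* a :* a :* b :* c :* e) :* d) ≈-refl
    regroup₃ : ∀ a b c d e → a ⊛ a ⊛ a ⊛ b ⊛ c ⊛ d ⊛ e ≈ (a ⊛ a ⊛ b ⊛ d ⊛ e) ⊛ (c ⊛ a)
    regroup₃ = solve 5 (λ a b c d e → a :* a :* a :* b :* c :* d :* e := (a :* a :* b :* d :* e) :* (c :* a)) ≈-refl
    term₁ : Nonneg ((n₁ ⊛ 1−x²) ⊛ inv (V ⊛ E))
    term₁ = nonneg-cancel nonneg-n₁ (1−x²⁻¹≥0 · 1−x²⁻¹≥0 · 1−y²⁻¹≥0 · 1−q²⁻¹≥0 · 1−w⁻¹≥0 · E⁻¹≥0)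
                          (constant-one 1−x²⁻¹≥0) (regroup₁ 1−x² 1−y² 1−q² 1−w E)
    term₂ : Nonneg ((n₂ ⊛ 1−w) ⊛ inv (V ⊛ E))
    term₂ = nonneg-cancel nonneg-n₂ (1−x²⁻¹≥0 · 1−x²⁻¹≥0 · 1−x²⁻¹≥0 · 1−y²⁻¹≥0 · 1−q²⁻¹≥0 · E⁻¹≥0)
                          (constant-one 1−w⁻¹≥0) (regroup₂ 1−x² 1−y² 1−q² 1−w E)
    term₃ : Nonneg ((n₃ ⊛ (1−q² ⊛ 1−x²)) ⊛ inv (V ⊛ E))
    term₃ = nonneg-cancel nonneg-n₃ (1−x²⁻¹≥0 · 1−x²⁻¹≥0 · 1−y²⁻¹≥0 · 1−w⁻¹≥0 · E⁻¹≥0)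
                          (constant-one (1−q²⁻¹≥0 · 1−x²⁻¹≥0)) (regroup₃ 1−x² 1−y² 1−q² 1−w E)

lemma3p6 : (k : ℕ) → 1 ≤ k → (n : ℕ) → 0ℤ ≤ℤ F3 k n
lemma3p6 zero     ()
lemma3p6 (suc k′) _ = F3-nonneg k′
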